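{- If $G$ is a planar graph of girth at least five, then $\chi^\star_c(G)\le 4$. More generally, $\chi^\star_c(G)\le 4$ whenever $G$ is triangle-free and has maximum average degree less than $10/3$.
   Context: Graphs are finite and simple. The maximum average degree of $G$ is the maximum of $2|E(H)|/|V(H)|$ over all nonempty subgraphs $H$ of $G$. For a positive integer $k$, a $k$-cover of a graph $G$ is a pair $(\vec D,\sigma)$ where $\vec D$ is an orientation of $G$ and $\sigma$ assigns to each arc of $\vec D$ a permutation of $[k]$. A $(\vec D,\sigma)$-coloring is a map $\varphi:V(G)\to[k]$ with $\sigma(vw)(\varphi(v))\ne\varphi(w)$ for every arc $vw$. A $(\vec D,\sigma)$-packing is a collection $\varphi_1,\dots,\varphi_k$ of $(\vec D,\sigma)$-colorings with $\varphi_i(v)\ne\varphi_j(v)$ for every vertex $v$ and all distinct $i,j\in[k]$. $\chi^\star_c(G)$ is the minimum $k$ such that $G$ has a $(\vec D,\sigma)$-packing for every $k$-cover of $G$. -}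

module Defs where

open import Data.Nat using (ℕ; _≤_; _<_; _*_; _<ᵇ_)
open import Data.Bool using (Bool; true; false; _∧_; if_then_else_)
open import Data.Fin using (Fin; toℕ)
open import Data.Fin.Subset using (Subset; _∈_; ∣_∣; Nonempty)
open import Data.Fin.Permutation using (Permutation′; _⟨$⟩ʳ_)
open import Data.List using (List; map; allFin)
open import Data.Nat.ListAction using (sum)
open import Data.Product using (_×_; Σ; ∃; ∃-syntax)
open import Data.Sum using (_⊎_)
open import Relation.Binary.PropositionalEquality using (_≡_; _≢_)
open import Relation.Nullary using (¬_)

record Graph : Set where
  field
    n     : ℕ
    adj   : Fin n → Fin n → Bool
    sym   : ∀ u v → adj u v ≡ true → adj v u ≡ true
    irref : ∀ v → adj v v ≡ false
open Graph public

record Orientation (G : Graph) : Set where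
  field
    arc      : Fin (n G) → Fin (n G) → Bool
    arc⇒adj  : ∀ u v → arc u v ≡ true → adj G u v ≡ true
    adj⇒arc  : ∀ u v → adj G u v ≡ true → arc u v ≡ true ⊎ arc v u ≡ true
    antisym  : ∀ u v → arc u v ≡ true → arc v u ≡ false
open Orientation public

-- A k-cover (D, σ): an orientation together with a permutation of [k]
-- for each arc (values of σ on non-arcs are irrelevant).
record Cover (k : ℕ) (G : Graph) : Set where
  field
    D : Orientation G
    σ : Fin (n G) → Fin (n G) → Permutation′ k
open Cover public

IsCoverColoring : ∀ {k G} → Cover k G → (Fin (n G) → Fin k) → Set
IsCoverColoring {k} {G} c φ =
  ∀ v w → arc (D c) v w ≡ true → (σ c v w ⟨$⟩ʳ φ v) ≢ φ w

HasPacking : ∀ {k G} → Cover k G → Set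
HasPacking {k} {G} c =
  Σ (Fin k → Fin (n G) → Fin k) λ φ →
    (∀ i → IsCoverColoring c (φ i)) ×
    (∀ v i j → i ≢ j → φ i v ≢ φ j v)

-- χ*_c(G) ≤ m : some positive k ≤ m such that every k-cover has a packing
-- (χ*_c is the minimum such k).
χ⋆c≤ : Graph → ℕ → Set
χ⋆c≤ G m = ∃[ k ] (1 ≤ k × k ≤ m × ((c : Cover k G) → HasPacking c))

TriangleFree : Graph → Set
TriangleFree G = ∀ u v w →
  ¬ (adj G u v ≡ true × adj G v w ≡ true × adj G u w ≡ true)

edgeCount : ∀ {m} → (Fin m → Fin m → Bool) → ℕ
edgeCount {m} F = sum (map (λ i → sum (map (λ j →
  if (toℕ i <ᵇ toℕ j) ∧ F i j then 1 else 0) (allFin m))) (allFin m))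

IsSubgraph : (G : Graph) → Subset (n G) → (Fin (n G) → Fin (n G) → Bool) → Set
IsSubgraph G S F = ∀ u v → F u v ≡ true →
  adj G u v ≡ true × u ∈ S × v ∈ S

-- mad(G) < p/q : for every nonempty subgraph H, 2|E(H)|/|V(H)| < p/q,
-- i.e. q * 2|E(H)| < p * |V(H)|.
MadLessThan : Graph → ℕ → ℕ → Set
MadLessThan G p q = ∀ S F → IsSubgraph G S F → Nonempty S →
  q * (2 * edgeCount F) < p * ∣ S ∣

{-# OPTIONS --safe #-}
module Submission where

-- Induction on a vertex set S, building a partial packing, i.e. four colourings of G[S] distinct at every
-- vertex, recorded as a permutation i ↦ φᵢ(v) of [4] at each vertex. A vertex of degree at most 2 is
-- reducible since two permutations of [4] always admit a third one discordant with both; a vertex of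
-- degree at most 3 with two neighbours of degree at most 3 is reducible by a finite check on the
-- permutations of [4] (its two neighbours are non-adjacent because G is triangle-free). When neither
-- occurs, discharging yields 20|S| ≤ 6·2|E(G[S])|, contradicting mad(G) < 10/3.

open import Defs hiding (sym)

open import Algebra.Bundles using (CommutativeMonoid)
open import Data.Bool using (Bool; true; false; _∧_; not; if_then_else_)
import Data.Bool as Bool
open import Data.Bool.Properties using (∧-zeroʳ; ∧-conicalˡ; ∧-conicalʳ; T-≡; ∧-commutativeMonoid)
open import Data.Fin using (Fin; zero; suc; toℕ; _≟_; punchOut)
open import Data.Fin.Permutation using (_⟨$⟩ʳ_; _⟨$⟩ˡ_; inverseˡ; inverseʳ)
open import Data.Fin.Properties using (all?; any?; pigeonhole; punchOut-injective; <⇒≢; suc-injective; toℕ-injective)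
open import Data.Fin.Subset using (Subset; _∈_; _∉_; _⊆_; _∩_; _-_; _─_; ⁅_⁆; ∣_∣; ⊤; Empty; outside)
open import Data.Fin.Subset.Properties
  using (_∈?_; ∈⊤; ∣p∣≤n; nonempty?; x∈p∩q⁺; x∈p∩q⁻; p─q⊆p; p⊆q⇒∣p∣≤∣q∣; x∈p⇒∣p-x∣<∣p∣; x∈p∧x≢y⇒x∈p-y; x∉⁅y⁆⇒x≢y)
open import Data.List using (List; []; _∷_; [_]; map; filter; length; allFin; cartesianProductWith)
import Data.List.Base as L
open import Data.List.Membership.Propositional using (find) renaming (_∈_ to _∈ˡ_)
open import Data.List.Membership.Propositional.Properties using (∈-filter⁺; ∈-filter⁻; ∈-cartesianProductWith⁺; ∈-allFin)
open import Data.List.Properties using (map-tabulate)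
open import Data.List.Relation.Binary.Pointwise using (Pointwise; []; _∷_)
open import Data.List.Relation.Unary.All as All using (All; []; _∷_)
open import Data.List.Relation.Unary.All.Properties using (map⁺)
open import Data.List.Relation.Unary.Any as Any using (Any)
open import Data.Nat using (ℕ; zero; suc; _+_; _*_; _≤_; _<_; _≤ᵇ_; _<ᵇ_; z≤n; s≤s)
open import Data.Nat.Properties
  using (+-*-semiring; _≤?_; _<?_; ≤-refl; ≤-reflexive; ≤-trans; ≤-<-trans; ≤-pred; <-trans; <-cmp; n<1+n; <⇒≱;
         ≰⇒>; ≤-antisym; <-irrefl; ≤ᵇ⇒≤; +-suc; +-comm; +-identityʳ; *-assoc; m≤m+n; +-mono-≤; +-monoˡ-≤;
         +-monoʳ-≤; *-monoʳ-≤; *-monoʳ-<; +-cancelʳ-≤; module ≤-Reasoning)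
import Data.Nat.ListAction as List
open import Data.Product using (Σ-syntax; ∃; ∃₂; ∃-syntax; _×_; _,_; proj₁; proj₂)
open import Data.Sum using (inj₁; inj₂)
open import Data.Vec using (Vec; []; _∷_; lookup; tabulate; here; there)
open import Data.Vec.Functional using (updateAt)
open import Data.Vec.Functional.Properties using (updateAt-updates; updateAt-minimal)
open import Data.Vec.Properties using (lookup∘tabulate; lookup⇒[]=; lookup-zipWith)
open import Function using (_∘_; id; const)
open import Function.Bundles using (Equivalence)
open import Function.Definitions using (Injective)
open import Relation.Binary.Definitions using (tri<; tri≈; tri>)
open import Relation.Binary.PropositionalEquality
  using (_≡_; _≢_; _≗_; refl; sym; trans; cong; cong₂; subst; subst₂; module ≡-Reasoning)
open import Relation.Nullary using (Dec; yes; no; ¬_; ¬?; _×-dec_; _→-dec_; map′; contradiction)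
open import Relation.Nullary.Decidable using (from-yes; dec-true; dec-false; decidable-stable)

open import Algebra.Properties.CommutativeSemigroup (CommutativeMonoid.commutativeSemigroup ∧-commutativeMonoid)
  using (xy∙z≈xz∙y)
open import Algebra.Properties.Semiring.Sum +-*-semiring
  using (sum; sum-syntax; sum-cong-≗; ∑-distrib-+; ∑-comm; *-distribˡ-sum; sum-replicate-zero)

-- Discordant permutations

injective⇒surjective : ∀ {n} (f : Fin n → Fin n) → Injective _≡_ _≡_ f → ∀ j → ∃ λ i → f i ≡ j
injective⇒surjective {suc n} f f-inj j with any? (λ i → f i ≟ j)
... | yes hit = hit
... | no miss =
  let i , i′ , i<i′ , eq = pigeonhole (n<1+n n) (λ i → punchOut (j≢f i))
  in contradiction (f-inj (punchOut-injective (j≢f i) (j≢f i′) eq)) (<⇒≢ i<i′)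
  where
  j≢f : ∀ i → j ≢ f i
  j≢f i j≡fi = miss (i , sym j≡fi)

left-inverse : ∀ {n} {f : Fin n → Fin n} → Injective _≡_ _≡_ f →
               ∃[ g ] Injective _≡_ _≡_ g × (∀ i → g (f i) ≡ i)
left-inverse {n} {f} f-inj = g , g-inj , λ i → f-inj (f∘g (f i))
  where
  g : Fin n → Fin n
  g j = proj₁ (injective⇒surjective f f-inj j)
  f∘g : ∀ j → f (g j) ≡ j
  f∘g j = proj₂ (injective⇒surjective f f-inj j)
  g-inj : Injective _≡_ _≡_ g
  g-inj {x} {y} gx≡gy = trans (sym (f∘g x)) (trans (cong f gx≡gy) (f∘g y))

left-inverse⇒injective : ∀ {A B : Set} {f : A → B} (g : B → A) → (∀ x → g (f x) ≡ x) → Injective _≡_ _≡_ f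
left-inverse⇒injective {f = f} g g∘f {x} {y} fx≡fy = trans (sym (g∘f x)) (trans (cong g fx≡fy) (g∘f y))

vectors : ∀ m n → List (Vec (Fin m) n)
vectors m zero    = [ [] ]
vectors m (suc n) = cartesianProductWith _∷_ (allFin m) (vectors m n)

∈-vectors : ∀ {m n} (v : Vec (Fin m) n) → v ∈ˡ vectors m n
∈-vectors []       = Any.here refl
∈-vectors (x ∷ xs) = ∈-cartesianProductWith⁺ _∷_ (∈-allFin x) (∈-vectors xs)

injective? : ∀ {m n} (f : Fin m → Fin n) → Dec (Injective _≡_ _≡_ f)
injective? f = map′ (λ inj {i} {j} → inj i j) (λ inj i j → inj)
                    (all? λ i → all? λ j → (f i ≟ f j) →-dec (i ≟ j))

module _ {A : Set} {P Q : A → Set} (P? : ∀ x → Dec (P x)) (Q? : ∀ x → Dec (Q x)) where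

  common-element : ∀ xs → length xs < length (filter P? xs) + length (filter Q? xs) →
                   Any (λ x → P x × Q x) xs
  common-element (x ∷ xs) h with P? x | Q? x
  ... | yes px | yes qx = Any.here (px , qx)
  ... | yes _  | no _   = Any.there (common-element xs (≤-pred h))
  ... | no _   | yes _  = Any.there (common-element xs (≤-pred (subst (suc (length xs) <_) (+-suc _ _) h)))
  ... | no _   | no _   = Any.there (common-element xs (<-trans (n<1+n _) h))

Discordant : ∀ {m n} → (Fin m → Fin n) → (Fin m → Fin n) → Set
Discordant f g = ∀ i → f i ≢ g i

discordant? : ∀ {m n} (f g : Fin m → Fin n) → Dec (Discordant f g)
discordant? f g = all? λ i → ¬? (f i ≟ g i)

Avoiding : ∀ {k} → List (Fin k → Fin k) → Set
Avoiding {k} fs = Σ[ h ∈ (Fin k → Fin k) ] Injective _≡_ _≡_ h × All (Discordant h) fs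

avoiding-∘ : ∀ {k} {π : Fin k → Fin k} {fs} → Injective _≡_ _≡_ π → Avoiding fs → Avoiding (map (_∘ π) fs)
avoiding-∘ π-inj (h , h-inj , h#fs) = h ∘ _ , π-inj ∘ h-inj , map⁺ (All.map (λ h#f → h#f ∘ _) h#fs)

avoiding-resp : ∀ {k} {fs gs : List (Fin k → Fin k)} → Pointwise _≗_ fs gs → Avoiding fs → Avoiding gs
avoiding-resp fs≗gs (h , h-inj , h#fs) = h , h-inj , resp fs≗gs h#fs
  where
  resp : ∀ {fs gs} → Pointwise _≗_ fs gs → All (Discordant h) fs → All (Discordant h) gs
  resp []              []            = []
  resp (f≗g ∷ fs≗gs) (h#f ∷ h#fs) = (λ i e → h#f i (trans e (sym (f≗g i)))) ∷ resp fs≗gs h#fs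

permutations : ∀ k → List (Vec (Fin k) k)
permutations k = filter (injective? ∘ lookup) (vectors k k)

tabulate∈permutations : ∀ {k} {f : Fin k → Fin k} → Injective _≡_ _≡_ f → tabulate f ∈ˡ permutations k
tabulate∈permutations {f = f} f-inj = ∈-filter⁺ (injective? ∘ lookup) (∈-vectors (tabulate f))
  (λ {i} {j} e → f-inj (trans (sym (lookup∘tabulate f i)) (trans e (lookup∘tabulate f j))))

∈permutations⇒injective : ∀ {k} {p : Vec (Fin k) k} → p ∈ˡ permutations k → Injective _≡_ _≡_ (lookup p)
∈permutations⇒injective {k} p∈ = proj₂ (∈-filter⁻ (injective? ∘ lookup) {xs = vectors k k} p∈)

derangements : ∀ k → List (Vec (Fin k) k)
derangements k = filter (λ p → discordant? (lookup p) id) (permutations k)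

AvoidableIn : ∀ {k} → List (Vec (Fin k) k) → List (Vec (Fin k) k) → Set
AvoidableIn ps vs = Any (λ h → All (λ v → Discordant (lookup h) (lookup v)) vs) ps

avoidable? : ∀ {k} ps (vs : List (Vec (Fin k) k)) → Dec (AvoidableIn ps vs)
avoidable? ps vs = Any.any? (λ h → All.all? (λ v → discordant? (lookup h) (lookup v)) vs) ps

avoidable⇒avoiding : ∀ {k} {vs} → AvoidableIn (permutations k) vs → Avoiding (map lookup vs)
avoidable⇒avoiding av = let h , h∈ , h#vs = find av in lookup h , ∈permutations⇒injective h∈ , map⁺ h#vs

AllPairs : ∀ {A : Set} → (A → A → Set) → List A → Set
AllPairs R xs = All (λ a → All (R a) xs) xs

extendable : ∀ {k} → List (Vec (Fin k) k) → List (Vec (Fin k) k) → Vec (Fin k) k → Vec (Fin k) k → List (Vec (Fin k) k)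
extendable ps ds a b = filter (λ p → avoidable? ps (p ∷ a ∷ b ∷ [])) ds

-- The lists are arguments, not constants, so that the evaluator computes them only once.
avoidable-pairs? : ∀ {k} ps → Dec (AllPairs (λ a b → AvoidableIn {k} ps (a ∷ b ∷ [])) ps)
avoidable-pairs? ps = All.all? (λ a → All.all? (λ b → avoidable? ps (a ∷ b ∷ [])) ps) ps

five-good? : ∀ {k} ps ds → Dec (AllPairs (λ a b → 5 ≤ length (extendable {k} ps ds a b)) ps)
five-good? ps ds = All.all? (λ a → All.all? (λ b → 5 ≤? length (extendable ps ds a b)) ps) ps

opaque
  avoidable-pairs : AllPairs (λ a b → AvoidableIn (permutations 4) (a ∷ b ∷ [])) (permutations 4)
  avoidable-pairs = from-yes (avoidable-pairs? (permutations 4))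

  five-good : AllPairs (λ a b → 5 ≤ length (extendable (permutations 4) (derangements 4) a b)) (permutations 4)
  five-good = from-yes (five-good? (permutations 4) (derangements 4))

length-derangements : length (derangements 4) ≡ 9
length-derangements = refl

avoiding-pair : ∀ {f g : Fin 4 → Fin 4} → Injective _≡_ _≡_ f → Injective _≡_ _≡_ g → Avoiding (f ∷ g ∷ [])
avoiding-pair {f} {g} f-inj g-inj =
  avoiding-resp (lookup∘tabulate f ∷ lookup∘tabulate g ∷ [])
    (avoidable⇒avoiding (All.lookup (All.lookup avoidable-pairs (tabulate∈permutations f-inj)) (tabulate∈permutations g-inj)))

-- For every pair of constraints at least five of the nine derangements extend, and 5 + 5 > 9.
common-good-derangement : ∀ {a₁ a₂ b₁ b₂ : Vec (Fin 4) 4} →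
  a₁ ∈ˡ permutations 4 → a₂ ∈ˡ permutations 4 → b₁ ∈ˡ permutations 4 → b₂ ∈ˡ permutations 4 →
  ∃[ p ] p ∈ˡ permutations 4 × Discordant (lookup p) id ×
         AvoidableIn (permutations 4) (p ∷ a₁ ∷ a₂ ∷ []) × AvoidableIn (permutations 4) (p ∷ b₁ ∷ b₂ ∷ [])
common-good-derangement {a₁} {a₂} {b₁} {b₂} a₁∈ a₂∈ b₁∈ b₂∈ =
  let p , p∈D , avA , avB = find (common-element (good a₁ a₂) (good b₁ b₂) (derangements 4) nine<five+five)
      p∈P , p-deranged = ∈-filter⁻ (λ p → discordant? (lookup p) id) {xs = permutations 4} p∈D
  in p , p∈P , p-deranged , avA , avB
  where
  good : ∀ a b p → Dec (AvoidableIn (permutations 4) (p ∷ a ∷ b ∷ []))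
  good a b p = avoidable? (permutations 4) (p ∷ a ∷ b ∷ [])
  five : ∀ {a b} → a ∈ˡ permutations 4 → b ∈ˡ permutations 4 →
         5 ≤ length (extendable (permutations 4) (derangements 4) a b)
  five a∈ b∈ = All.lookup (All.lookup five-good a∈) b∈
  nine<five+five : length (derangements 4) < length (extendable (permutations 4) (derangements 4) a₁ a₂)
                                            + length (extendable (permutations 4) (derangements 4) b₁ b₂)
  nine<five+five = ≤-trans (≤-reflexive (cong suc length-derangements)) (+-mono-≤ (five a₁∈ a₂∈) (five b₁∈ b₂∈))

avoiding-relabelled : ∀ {k} {c c⁻¹ : Fin k → Fin k} → Injective _≡_ _≡_ c → (∀ i → c⁻¹ (c i) ≡ i) → ∀ {p} f g →
  AvoidableIn (permutations k) (p ∷ tabulate (f ∘ c⁻¹) ∷ tabulate (g ∘ c⁻¹) ∷ []) →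
  Avoiding (lookup p ∘ c ∷ f ∷ g ∷ [])
avoiding-relabelled {c = c} {c⁻¹} c-inj c⁻¹∘c f g av =
  avoiding-resp ((λ _ → refl) ∷ back f ∷ back g ∷ []) (avoiding-∘ c-inj (avoidable⇒avoiding av))
  where
  back : ∀ f → lookup (tabulate (f ∘ c⁻¹)) ∘ c ≗ f
  back f i = trans (lookup∘tabulate (f ∘ c⁻¹) (c i)) (cong f (c⁻¹∘c i))

-- Relabelling the positions by c⁻¹ turns c into the identity.
avoiding-star : ∀ {c a₁ a₂ b₁ b₂ : Fin 4 → Fin 4} →
  Injective _≡_ _≡_ c → Injective _≡_ _≡_ a₁ → Injective _≡_ _≡_ a₂ → Injective _≡_ _≡_ b₁ → Injective _≡_ _≡_ b₂ →
  ∃[ P ] Injective _≡_ _≡_ P × Discordant P c × Avoiding (P ∷ a₁ ∷ a₂ ∷ []) × Avoiding (P ∷ b₁ ∷ b₂ ∷ [])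
avoiding-star {c} {a₁} {a₂} {b₁} {b₂} c-inj a₁-inj a₂-inj b₁-inj b₂-inj =
  let c⁻¹ , c⁻¹-inj , c⁻¹∘c = left-inverse c-inj
      p , p∈ , p-deranged , avA , avB = common-good-derangement
        (tabulate∈permutations (c⁻¹-inj ∘ a₁-inj)) (tabulate∈permutations (c⁻¹-inj ∘ a₂-inj))
        (tabulate∈permutations (c⁻¹-inj ∘ b₁-inj)) (tabulate∈permutations (c⁻¹-inj ∘ b₂-inj))
  in lookup p ∘ c , c-inj ∘ ∈permutations⇒injective p∈ , p-deranged ∘ c ,
     avoiding-relabelled {c⁻¹ = c⁻¹} c-inj c⁻¹∘c a₁ a₂ avA , avoiding-relabelled {c⁻¹ = c⁻¹} c-inj c⁻¹∘c b₁ b₂ avB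

Avoids : ∀ {k} {A : Set} → (Fin k → Fin k) → (A → Fin k → Fin k) → List A → Set
Avoids h f xs = ∀ {x} → x ∈ˡ xs → Discordant h (f x)

pad-to-single : ∀ {k} {A : Set} (f : A → Fin k → Fin k) → (∀ x → Injective _≡_ _≡_ (f x)) → ∀ {xs} → length xs ≤ 1 →
  ∃[ g ] Injective _≡_ _≡_ g × (∀ {h} → Discordant h g → Avoids h f xs)
pad-to-single f f-inj {[]}         _ = id , id , λ _ ()
pad-to-single f f-inj {x ∷ []}     _ = f x , f-inj x , λ { h#fx (Any.here refl) → h#fx }
pad-to-single f f-inj {_ ∷ _ ∷ _} (s≤s ())

pad-to-pair : ∀ {k} {A : Set} (f : A → Fin k → Fin k) → (∀ x → Injective _≡_ _≡_ (f x)) → ∀ {xs} → length xs ≤ 2 →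
  ∃₂ λ g₁ g₂ → Injective _≡_ _≡_ g₁ × Injective _≡_ _≡_ g₂ × (∀ {h} → Discordant h g₁ → Discordant h g₂ → Avoids h f xs)
pad-to-pair f f-inj {[]}             _ = id , id , id , id , λ _ _ ()
pad-to-pair f f-inj {x ∷ []}         _ = f x , f x , f-inj x , f-inj x , λ { h#fx _ (Any.here refl) → h#fx }
pad-to-pair f f-inj {x ∷ y ∷ []}     _ = f x , f y , f-inj x , f-inj y ,
  λ { h#fx _ (Any.here refl) → h#fx ; _ h#fy (Any.there (Any.here refl)) → h#fy }
pad-to-pair f f-inj {_ ∷ _ ∷ _ ∷ _} (s≤s (s≤s ()))

-- Opaque: unfolding these would make the type checker evaluate the permutation tables.
opaque
  avoid-≤2 : ∀ {A : Set} (f : A → Fin 4 → Fin 4) → (∀ x → Injective _≡_ _≡_ (f x)) → ∀ {xs} → length xs ≤ 2 →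
    ∃[ h ] Injective _≡_ _≡_ h × Avoids h f xs
  avoid-≤2 f f-inj |xs|≤2 =
    let g₁ , g₂ , g₁-inj , g₂-inj , avoids = pad-to-pair f f-inj |xs|≤2
    in avoiding-family avoids (avoiding-pair g₁-inj g₂-inj)
    where
    avoiding-family : ∀ {g₁ g₂ xs} → (∀ {h} → Discordant h g₁ → Discordant h g₂ → Avoids h f xs) →
                      Avoiding (g₁ ∷ g₂ ∷ []) → ∃[ h ] Injective _≡_ _≡_ h × Avoids h f xs
    avoiding-family avoids (h , h-inj , h#g₁ ∷ h#g₂ ∷ []) = h , h-inj , avoids h#g₁ h#g₂

  avoid-star-≤ : ∀ {A : Set} (fc fa fb : A → Fin 4 → Fin 4) →
    (∀ x → Injective _≡_ _≡_ (fc x)) → (∀ x → Injective _≡_ _≡_ (fa x)) → (∀ x → Injective _≡_ _≡_ (fb x)) →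
    ∀ {cs as bs} → length cs ≤ 1 → length as ≤ 2 → length bs ≤ 2 →
    ∃[ P ] Injective _≡_ _≡_ P × Avoids P fc cs ×
           (∃[ Q ] Injective _≡_ _≡_ Q × Discordant Q P × Avoids Q fa as) ×
           (∃[ Q ] Injective _≡_ _≡_ Q × Discordant Q P × Avoids Q fb bs)
  avoid-star-≤ {A} fc fa fb fc-inj fa-inj fb-inj |cs|≤1 |as|≤2 |bs|≤2 =
    let c , c-inj , avoids-c = pad-to-single fc fc-inj |cs|≤1
        a₁ , a₂ , a₁-inj , a₂-inj , avoids-a = pad-to-pair fa fa-inj |as|≤2
        b₁ , b₂ , b₁-inj , b₂-inj , avoids-b = pad-to-pair fb fb-inj |bs|≤2
        P , P-inj , P#c , Qa , Qb = avoiding-star c-inj a₁-inj a₂-inj b₁-inj b₂-inj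
    in P , P-inj , avoids-c P#c , extension avoids-a Qa , extension avoids-b Qb
    where
    extension : ∀ {P g₁ g₂} {f : A → Fin 4 → Fin 4} {xs} → (∀ {h} → Discordant h g₁ → Discordant h g₂ → Avoids h f xs) →
                Avoiding (P ∷ g₁ ∷ g₂ ∷ []) → ∃[ Q ] Injective _≡_ _≡_ Q × Discordant Q P × Avoids Q f xs
    extension avoids (Q , Q-inj , Q#P ∷ Q#g₁ ∷ Q#g₂ ∷ []) = Q , Q-inj , Q#P , avoids Q#g₁ Q#g₂

-- Subsets and counting

x∈p─q⇒x∉q : ∀ {n} {x : Fin n} (p q : Subset n) → x ∈ p ─ q → x ∉ q
x∈p─q⇒x∉q (_ ∷ p) (outside ∷ q) here        ()
x∈p─q⇒x∉q (_ ∷ p) (_       ∷ q) (there x∈) (there x∈q) = x∈p─q⇒x∉q p q x∈ x∈q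

x∈p-y⇒x≢y : ∀ {n} {x y : Fin n} {p : Subset n} → x ∈ p - y → x ≢ y
x∈p-y⇒x≢y {y = y} {p} x∈ = x∉⁅y⁆⇒x≢y (x∈p─q⇒x∉q p ⁅ y ⁆ x∈)

x∈p⇒0<∣p∣ : ∀ {n} {x : Fin n} {p : Subset n} → x ∈ p → 0 < ∣ p ∣
x∈p⇒0<∣p∣ x∈p = ≤-<-trans z≤n (x∈p⇒∣p-x∣<∣p∣ x∈p)

covering : ∀ {n} k (p : Subset n) → ∣ p ∣ ≤ k → ∃[ ws ] length ws ≤ k × (∀ {x} → x ∈ p → x ∈ˡ ws)
covering zero p ∣p∣≤0 = [] , z≤n , λ x∈p → contradiction ∣p∣≤0 (<⇒≱ (x∈p⇒0<∣p∣ x∈p))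
covering (suc k) p ∣p∣≤k+1 with nonempty? p
... | no ∅ = [] , z≤n , λ x∈p → contradiction (_ , x∈p) ∅
... | yes (a , a∈p) =
  let ws , len , covers = covering k (p - a) (≤-pred (≤-trans (x∈p⇒∣p-x∣<∣p∣ a∈p) ∣p∣≤k+1))
  in a ∷ ws , s≤s len , cover covers
  where
  cover : ∀ {ws} → (∀ {x} → x ∈ p - a → x ∈ˡ ws) → ∀ {x} → x ∈ p → x ∈ˡ a ∷ ws
  cover covers {x} x∈p with x ≟ a
  ... | yes x≡a = Any.here x≡a
  ... | no x≢a = Any.there (covers (x∈p∧x≢y⇒x∈p-y x∈p x≢a))

𝟙 : Bool → ℕ
𝟙 b = if b then 1 else 0

count : ∀ {m} → (Fin m → Bool) → ℕ
count {m} p = ∑[ i < m ] 𝟙 (p i)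

sum-mono-≤ : ∀ {m} {f g : Fin m → ℕ} → (∀ i → f i ≤ g i) → sum f ≤ sum g
sum-mono-≤ {zero} f≤g = z≤n
sum-mono-≤ {suc m} f≤g = +-mono-≤ (f≤g zero) (sum-mono-≤ (f≤g ∘ suc))

count-mono : ∀ {m} {p q : Fin m → Bool} → (∀ i → p i ≡ true → q i ≡ true) → count p ≤ count q
count-mono {p = p} {q} p⇒q = sum-mono-≤ 𝟙-mono
  where
  𝟙-mono : ∀ i → 𝟙 (p i) ≤ 𝟙 (q i)
  𝟙-mono i with p i in e
  ... | false = z≤n
  ... | true rewrite p⇒q i e = ≤-refl

count-split : ∀ {m} (p q : Fin m → Bool) → count p ≡ count (λ i → p i ∧ q i) + count (λ i → p i ∧ not (q i))
count-split p q = trans (sum-cong-≗ split) (∑-distrib-+ (λ i → 𝟙 (p i ∧ q i)) (λ i → 𝟙 (p i ∧ not (q i))))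
  where
  split : ∀ i → 𝟙 (p i) ≡ 𝟙 (p i ∧ q i) + 𝟙 (p i ∧ not (q i))
  split i with p i | q i
  ... | false | _     = refl
  ... | true  | true  = refl
  ... | true  | false = refl

count-unique : ∀ {m} (p : Fin m → Bool) → (∀ i j → p i ≡ true → p j ≡ true → i ≡ j) → count p ≤ 1
count-unique {zero} p unique = z≤n
count-unique {suc m} p unique with p zero in p0
... | true  = s≤s (≤-trans (count-mono {q = λ _ → false} rest-false) (≤-reflexive (sum-replicate-zero m)))
  where
  rest-false : ∀ i → p (suc i) ≡ true → false ≡ true
  rest-false i e with unique zero (suc i) p0 e
  ... | ()
... | false = count-unique (p ∘ suc) (λ i j pi pj → suc-injective (unique (suc i) (suc j) pi pj))

∣p∣≡count : ∀ {n} (p : Subset n) → ∣ p ∣ ≡ count (lookup p)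
∣p∣≡count []          = refl
∣p∣≡count (true ∷ p)  = cong suc (∣p∣≡count p)
∣p∣≡count (false ∷ p) = ∣p∣≡count p

sum-allFin : ∀ {m} (f : Fin m → ℕ) → List.sum (map f (allFin m)) ≡ sum f
sum-allFin {m} f = trans (cong List.sum (map-tabulate id f)) (sum-tabulate f)
  where
  sum-tabulate : ∀ {m} (f : Fin m → ℕ) → List.sum (L.tabulate f) ≡ sum f
  sum-tabulate {zero} f = refl
  sum-tabulate {suc m} f = cong (f zero +_) (sum-tabulate (f ∘ suc))

_<ᶠ_ : ∀ {m} → Fin m → Fin m → Bool
i <ᶠ j = toℕ i <ᵇ toℕ j

handshake : ∀ {m} (F : Fin m → Fin m → Bool) → (∀ i j → F i j ≡ F j i) → (∀ i → F i i ≡ false) →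
  ∑[ i < m ] count (F i) ≡ 2 * edgeCount F
handshake {m} F F-sym F-irrefl = begin
  ∑[ i < m ] count (F i)
    ≡⟨ sum-cong-≗ (λ i → trans (sum-cong-≗ (split i)) (∑-distrib-+ (forward i) (backward i))) ⟩
  ∑[ i < m ] (∑[ j < m ] forward i j + ∑[ j < m ] backward i j)
    ≡⟨ ∑-distrib-+ (λ i → ∑[ j < m ] forward i j) (λ i → ∑[ j < m ] backward i j) ⟩
  ∑[ i < m ] ∑[ j < m ] forward i j + ∑[ i < m ] ∑[ j < m ] backward i j
    ≡⟨ cong (forwardSum +_) (trans (∑-comm backward) (sum-cong-≗ λ j → sum-cong-≗ λ i → cong (λ b → 𝟙 (j <ᶠ i ∧ b)) (F-sym i j))) ⟩
  forwardSum + forwardSum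
    ≡⟨ cong (λ x → x + x) (sym edgeCount≡) ⟩
  edgeCount F + edgeCount F
    ≡⟨ cong (edgeCount F +_) (sym (+-identityʳ _)) ⟩
  2 * edgeCount F ∎
  where
  open ≡-Reasoning
  forward backward : Fin m → Fin m → ℕ
  forward i j = 𝟙 (i <ᶠ j ∧ F i j)
  backward i j = 𝟙 (j <ᶠ i ∧ F i j)
  forwardSum : ℕ
  forwardSum = ∑[ i < m ] ∑[ j < m ] forward i j
  edgeCount≡ : edgeCount F ≡ forwardSum
  edgeCount≡ = trans (sum-allFin (λ i → List.sum (map (forward i) (allFin m)))) (sum-cong-≗ λ i → sum-allFin (forward i))
  <ᵇ-true : ∀ {a b} → a < b → (a <ᵇ b) ≡ true
  <ᵇ-true = dec-true (_ <? _)
  <ᵇ-false : ∀ {a b} → ¬ a < b → (a <ᵇ b) ≡ false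
  <ᵇ-false = dec-false (_ <? _)
  split : ∀ i j → 𝟙 (F i j) ≡ forward i j + backward i j
  split i j with <-cmp (toℕ i) (toℕ j)
  ... | tri< i<j _ j≮i rewrite <ᵇ-true i<j | <ᵇ-false j≮i = sym (+-identityʳ _)
  ... | tri> i≮j _ j<i rewrite <ᵇ-true j<i | <ᵇ-false i≮j = refl
  ... | tri≈ _ i≡j _ rewrite toℕ-injective i≡j | F-irrefl j = sym (cong (λ b → 𝟙 b + 𝟙 b) (∧-zeroʳ (toℕ j <ᵇ toℕ j)))

-- Partial packings

module _ {k} {G : Graph} (cover : Cover k G) where

  private
    V : Set
    V = Fin (n G)

    arcs : V → V → Bool
    arcs = arc (D cover)

  -- For an edge uw, a colour c at w forbids the colour transport u w c at u, whichever way uw is oriented.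
  transport : V → V → Fin k → Fin k
  transport u w = if arcs u w then σ cover u w ⟨$⟩ˡ_ else σ cover w u ⟨$⟩ʳ_

  transport-arc : ∀ {u w} → arcs u w ≡ true → ∀ c → transport u w c ≡ σ cover u w ⟨$⟩ˡ c
  transport-arc uw c rewrite uw = refl

  transport-reverse : ∀ {u w} → arcs u w ≡ true → ∀ c → transport w u c ≡ σ cover u w ⟨$⟩ʳ c
  transport-reverse {u} {w} uw c rewrite antisym (D cover) u w uw = refl

  transport-injective : ∀ u w → Injective _≡_ _≡_ (transport u w)
  transport-injective u w with arcs u w
  ... | true  = left-inverse⇒injective (σ cover u w ⟨$⟩ʳ_) (λ _ → inverseʳ (σ cover u w))
  ... | false = left-inverse⇒injective (σ cover w u ⟨$⟩ˡ_) (λ _ → inverseˡ (σ cover w u))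

  transport-inverse : ∀ {u w} → adj G u w ≡ true → ∀ c → transport u w (transport w u c) ≡ c
  transport-inverse {u} {w} uw c with adj⇒arc (D cover) u w uw
  ... | inj₁ u→w rewrite transport-reverse u→w c | transport-arc u→w (σ cover u w ⟨$⟩ʳ c) = inverseˡ (σ cover u w)
  ... | inj₂ w→u rewrite transport-arc w→u c | transport-reverse w→u (σ cover w u ⟨$⟩ˡ c) = inverseʳ (σ cover w u)

  discordant-transport : ∀ {u w} {f g : Fin k → Fin k} → adj G u w ≡ true →
    Discordant f (transport u w ∘ g) → Discordant (transport w u ∘ f) g
  discordant-transport {u} {w} {f} uw f#g i e = f#g i (trans (sym (transport-inverse uw (f i))) (cong (transport u w) e))

  discordant-round-trip : ∀ {u x} {Q C : Fin k → Fin k} → adj G u x ≡ true → Discordant Q C →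
               Discordant C (transport u x ∘ transport x u ∘ Q)
  discordant-round-trip {Q = Q} ux Q#C i e = Q#C i (trans (sym (transport-inverse ux (Q i))) (sym e))

  respects-from-tail : ∀ {v w} {f g : Fin k → Fin k} → arcs v w ≡ true →
    Discordant f (transport v w ∘ g) → Discordant ((σ cover v w ⟨$⟩ʳ_) ∘ f) g
  respects-from-tail {v} {w} {f} {g} vw f#g i σf≡g = f#g i (begin
    f i                                       ≡⟨ inverseˡ (σ cover v w) ⟨
    σ cover v w ⟨$⟩ˡ (σ cover v w ⟨$⟩ʳ f i)   ≡⟨ cong (σ cover v w ⟨$⟩ˡ_) σf≡g ⟩
    σ cover v w ⟨$⟩ˡ g i                      ≡⟨ transport-arc vw (g i) ⟨
    transport v w (g i)                       ∎)
    where open ≡-Reasoning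

  respects-from-head : ∀ {v w} {f g : Fin k → Fin k} → arcs v w ≡ true →
    Discordant g (transport w v ∘ f) → Discordant ((σ cover v w ⟨$⟩ʳ_) ∘ f) g
  respects-from-head {f = f} vw g#f i σf≡g = g#f i (trans (sym σf≡g) (sym (transport-reverse vw (f i))))

  -- colours v i is the colour φᵢ(v) of v in the i-th colouring.
  record Packing (S : Subset (n G)) : Set where
    field
      colours   : V → Fin k → Fin k
      injective : ∀ v → Injective _≡_ _≡_ (colours v)
      proper    : ∀ {v w} → v ∈ S → w ∈ S → arcs v w ≡ true →
                  Discordant ((σ cover v w ⟨$⟩ʳ_) ∘ colours v) (colours w)

  open Packing public

  empty-packing : ∀ {S} → Empty S → Packing S
  empty-packing ∅ = record
    { colours   = λ _ → id
    ; injective = λ _ → id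
    ; proper    = λ v∈S _ _ → contradiction (_ , v∈S) ∅
    }

  packing⇒hasPacking : Packing ⊤ → HasPacking cover
  packing⇒hasPacking P =
    (λ i v → colours P v i) , (λ i v w vw → proper P ∈⊤ ∈⊤ vw i) , λ v i j i≢j → i≢j ∘ injective P v

  extend : ∀ {S x} → x ∈ S → (P : Packing (S - x)) → (X : Fin k → Fin k) → Injective _≡_ _≡_ X →
           (∀ {w} → w ∈ S - x → adj G x w ≡ true → Discordant X (transport x w ∘ colours P w)) → Packing S
  extend {S} {x} x∈S P X X-inj X-ok = record
    { colours   = colours′
    ; injective = injective′
    ; proper    = proper′
    }
    where
    colours′ : V → Fin k → Fin k
    colours′ = updateAt (colours P) x (const X)
    injective′ : ∀ v → Injective _≡_ _≡_ (colours′ v)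
    injective′ v with v ≟ x
    ... | yes refl = subst (Injective _≡_ _≡_) (sym (updateAt-updates x (colours P))) X-inj
    ... | no v≢x   = subst (Injective _≡_ _≡_) (sym (updateAt-minimal v x (colours P) v≢x)) (injective P v)
    proper′ : ∀ {v w} → v ∈ S → w ∈ S → arcs v w ≡ true → Discordant ((σ cover v w ⟨$⟩ʳ_) ∘ colours′ v) (colours′ w)
    proper′ {v} {w} v∈S w∈S vw with v ≟ x | w ≟ x
    ... | yes refl | yes refl = contradiction (trans (sym (arc⇒adj (D cover) x x vw)) (irref G x)) λ ()
    ... | yes refl | no w≢x
      rewrite updateAt-updates x {const X} (colours P) | updateAt-minimal w x {const X} (colours P) w≢x
      = respects-from-tail vw (X-ok (x∈p∧x≢y⇒x∈p-y w∈S w≢x) (arc⇒adj (D cover) x w vw))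
    ... | no v≢x | yes refl
      rewrite updateAt-updates x {const X} (colours P) | updateAt-minimal v x {const X} (colours P) v≢x
      = respects-from-head vw (X-ok (x∈p∧x≢y⇒x∈p-y v∈S v≢x) (Graph.sym G v x (arc⇒adj (D cover) v x vw)))
    ... | no v≢x | no w≢x
      rewrite updateAt-minimal v x {const X} (colours P) v≢x | updateAt-minimal w x {const X} (colours P) w≢x
      = proper P (x∈p∧x≢y⇒x∈p-y v∈S v≢x) (x∈p∧x≢y⇒x∈p-y w∈S w≢x) vw

  -- The new colours at x are given in the frame of its neighbour u.
  extend-from : ∀ {S x u} → adj G u x ≡ true → x ∈ S → (P : Packing (S - x)) →
    (Q : Fin k → Fin k) → Injective _≡_ _≡_ Q →
    (∀ {w} → w ∈ S - x → adj G x w ≡ true → Discordant Q (transport u x ∘ transport x w ∘ colours P w)) → Packing S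
  extend-from {x = x} {u} ux x∈S P Q Q-inj Q-ok =
    extend x∈S P (transport x u ∘ Q) (Q-inj ∘ transport-injective x u) λ w∈ xw → discordant-transport ux (Q-ok w∈ xw)

module Degrees (G : Graph) where

  adj-irrefl : ∀ {v} → adj G v v ≢ true
  adj-irrefl {v} vv = contradiction (trans (sym vv) (irref G v)) λ ()

  adj-comm : ∀ u w → adj G u w ≡ adj G w u
  adj-comm u w with adj G u w in uw | adj G w u in wu
  ... | true  | true  = refl
  ... | false | false = refl
  ... | true  | false = contradiction (trans (sym (Graph.sym G u w uw)) wu) λ ()
  ... | false | true  = contradiction (trans (sym (Graph.sym G w u wu)) uw) λ ()

  neighbours : Fin (n G) → Subset (n G)
  neighbours v = tabulate (adj G v)

  ∈-neighbours⁺ : ∀ {v w} → adj G v w ≡ true → w ∈ neighbours v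
  ∈-neighbours⁺ {v} {w} vw = lookup⇒[]= w (neighbours v) (trans (lookup∘tabulate (adj G v) w) vw)

  deg : Subset (n G) → Fin (n G) → ℕ
  deg S v = ∣ S ∩ neighbours v ∣

  deg-mono : ∀ {S T v} → S ⊆ T → deg S v ≤ deg T v
  deg-mono {S} {T} {v} S⊆T = p⊆q⇒∣p∣≤∣q∣ λ w∈ →
    let w∈S , w∈N = x∈p∩q⁻ S (neighbours v) w∈ in x∈p∩q⁺ (S⊆T w∈S , w∈N)

  deg-remove : ∀ {S x v} → x ∈ S → adj G v x ≡ true → deg (S - x) v < deg S v
  deg-remove {S} {x} {v} x∈S vx =
    ≤-<-trans (p⊆q⇒∣p∣≤∣q∣ shrink) (x∈p⇒∣p-x∣<∣p∣ (x∈p∩q⁺ (x∈S , ∈-neighbours⁺ vx)))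
    where
    shrink : (S - x) ∩ neighbours v ⊆ (S ∩ neighbours v) - x
    shrink w∈ = let w∈S-x , w∈N = x∈p∩q⁻ (S - x) (neighbours v) w∈
                in x∈p∧x≢y⇒x∈p-y (x∈p∩q⁺ (p─q⊆p S ⁅ x ⁆ w∈S-x , w∈N)) (x∈p-y⇒x≢y w∈S-x)

  neighbour-list : ∀ {S v k} → deg S v ≤ k →
    ∃[ ws ] length ws ≤ k × (∀ {w} → w ∈ S → adj G v w ≡ true → w ∈ˡ ws)
  neighbour-list {S} {v} {k} deg≤k =
    let ws , |ws|≤k , covers = covering k (S ∩ neighbours v) deg≤k
    in ws , |ws|≤k , λ w∈S vw → covers (x∈p∩q⁺ (w∈S , ∈-neighbours⁺ vw))

  deg≡count : ∀ S v → deg S v ≡ count (λ w → lookup S w ∧ adj G v w)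
  deg≡count S v = trans (∣p∣≡count (S ∩ neighbours v)) (sum-cong-≗ λ w →
    cong 𝟙 (trans (lookup-zipWith _∧_ w S (neighbours v)) (cong (lookup S w ∧_) (lookup∘tabulate (adj G v) w))))

  LowVertex : Subset (n G) → Set
  LowVertex S = ∃[ v ] v ∈ S × deg S v ≤ 2

  lowVertex? : ∀ S → Dec (LowVertex S)
  lowVertex? S = any? λ v → (v ∈? S) ×-dec (deg S v ≤? 2)

  LightPath : Subset (n G) → Set
  LightPath S = ∃[ v ] ∃[ a ] ∃[ b ] (v ∈ S × a ∈ S × b ∈ S) × a ≢ b × adj G v a ≡ true × adj G v b ≡ true ×
                                      deg S v ≤ 3 × deg S a ≤ 3 × deg S b ≤ 3

  lightPath? : ∀ S → Dec (LightPath S)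
  lightPath? S = any? λ v → any? λ a → any? λ b →
    ((v ∈? S) ×-dec (a ∈? S) ×-dec (b ∈? S)) ×-dec ¬? (a ≟ b) ×-dec (adj G v a Bool.≟ true) ×-dec (adj G v b Bool.≟ true) ×-dec
    (deg S v ≤? 3) ×-dec (deg S a ≤? 3) ×-dec (deg S b ≤? 3)

module Reductions {G : Graph} (triangle-free : TriangleFree G) (cover : Cover 4 G) where

  open Degrees G

  private
    V : Set
    V = Fin (n G)

  seen : ∀ {S} → Packing cover S → V → V → Fin 4 → Fin 4
  seen P u w = transport cover u w ∘ colours P w

  seen-injective : ∀ {S} (P : Packing cover S) u w → Injective _≡_ _≡_ (seen P u w)
  seen-injective P u w = injective P w ∘ transport-injective cover u w

  reduce-low-degree : ∀ {S v} → v ∈ S → deg S v ≤ 2 → Packing cover (S - v) → Packing cover S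
  reduce-low-degree {S} {v} v∈S deg≤2 P =
    let ws , |ws|≤2 , covers = neighbour-list (≤-trans (deg-mono (p─q⊆p S ⁅ v ⁆)) deg≤2)
        X , X-inj , X-avoids = avoid-≤2 (seen P v) (seen-injective P v) |ws|≤2
    in extend cover v∈S P X X-inj λ w∈ vw → X-avoids (covers w∈ vw)

  reattach-path : ∀ {S v a b} → v ∈ S → a ∈ S - v → b ∈ S - v - a → adj G v a ≡ true → adj G v b ≡ true →
    (P₀ : Packing cover (S - v - a - b)) → (C Qa Qb : Fin 4 → Fin 4) →
    Injective _≡_ _≡_ C → Injective _≡_ _≡_ Qa → Injective _≡_ _≡_ Qb → Discordant Qa C → Discordant Qb C →
    (∀ {w} → w ∈ S - v - a - b → adj G v w ≡ true → Discordant C (seen P₀ v w)) →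
    (∀ {w} → w ∈ S - v - a - b → adj G a w ≡ true → Discordant Qa (transport cover v a ∘ seen P₀ a w)) →
    (∀ {w} → w ∈ S - v - a - b → adj G b w ≡ true → Discordant Qb (transport cover v b ∘ seen P₀ b w)) →
    Packing cover S
  reattach-path {S} {v} {a} {b} v∈S a∈S-v b∈S-v-a va vb P₀ C Qa Qb C-inj Qa-inj Qb-inj Qa#C Qb#C C-ok Qa-ok Qb-ok =
    extend cover v∈S P₂ C C-inj centre-ok
    where
    not-b : ∀ {w} → adj G a w ≡ true → w ≢ b
    not-b aw refl = triangle-free v a b (va , aw , vb)
    P₁ : Packing cover (S - v - a)
    P₁ = extend-from cover vb b∈S-v-a P₀ Qb Qb-inj Qb-ok
    P₂ : Packing cover (S - v)
    P₂ = extend-from cover va a∈S-v P₁ Qa Qa-inj λ {w} w∈ aw →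
      subst (λ c → Discordant Qa (transport cover v a ∘ transport cover a w ∘ c))
            (sym (updateAt-minimal w b (colours P₀) (not-b aw))) (Qa-ok (x∈p∧x≢y⇒x∈p-y w∈ (not-b aw)) aw)
    colours-a : colours P₂ a ≡ transport cover a v ∘ Qa
    colours-a = updateAt-updates a (colours P₁)
    colours-b : colours P₂ b ≡ transport cover b v ∘ Qb
    colours-b = trans (updateAt-minimal b a (colours P₁) (x∈p-y⇒x≢y b∈S-v-a)) (updateAt-updates b (colours P₀))
    colours-T : ∀ {w} → w ≢ a → w ≢ b → colours P₂ w ≡ colours P₀ w
    colours-T {w} w≢a w≢b = trans (updateAt-minimal w a (colours P₁) w≢a) (updateAt-minimal w b (colours P₀) w≢b)
    centre-ok : ∀ {w} → w ∈ S - v → adj G v w ≡ true → Discordant C (transport cover v w ∘ colours P₂ w)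
    centre-ok {w} w∈ vw with w ≟ a | w ≟ b
    ... | yes refl | _        rewrite colours-a = discordant-round-trip cover va Qa#C
    ... | no _     | yes refl rewrite colours-b = discordant-round-trip cover vb Qb#C
    ... | no w≢a   | no w≢b   rewrite colours-T w≢a w≢b = C-ok (x∈p∧x≢y⇒x∈p-y (x∈p∧x≢y⇒x∈p-y w∈ w≢a) w≢b) vw

  reduce-path : ∀ {S v a b} → v ∈ S → a ∈ S → b ∈ S → a ≢ b → adj G v a ≡ true → adj G v b ≡ true →
    deg S v ≤ 3 → deg S a ≤ 3 → deg S b ≤ 3 → Packing cover (S - v - a - b) → Packing cover S
  reduce-path {S} {v} {a} {b} v∈S a∈S b∈S a≢b va vb deg-v deg-a deg-b P₀ =
    let cs , |cs|≤1 , cs-cover = neighbour-list deg-T-v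
        as , |as|≤2 , as-cover = neighbour-list (deg-T (Graph.sym G v a va) deg-a)
        bs , |bs|≤2 , bs-cover = neighbour-list (deg-T (Graph.sym G v b vb) deg-b)
        C , C-inj , C-avoids , (Qa , Qa-inj , Qa#C , Qa-avoids) , (Qb , Qb-inj , Qb#C , Qb-avoids) =
          avoid-star-≤ (seen P₀ v) (λ w → transport cover v a ∘ seen P₀ a w) (λ w → transport cover v b ∘ seen P₀ b w)
                     (seen-injective P₀ v) (λ w → seen-injective P₀ a w ∘ transport-injective cover v a)
                     (λ w → seen-injective P₀ b w ∘ transport-injective cover v b) |cs|≤1 |as|≤2 |bs|≤2
    in reattach-path v∈S a∈S-v b∈S-v-a va vb P₀ C Qa Qb C-inj Qa-inj Qb-inj Qa#C Qb#C
         (λ w∈ vw → C-avoids (cs-cover w∈ vw)) (λ w∈ aw → Qa-avoids (as-cover w∈ aw)) (λ w∈ bw → Qb-avoids (bs-cover w∈ bw))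
    where
    T : Subset (n G)
    T = S - v - a - b
    a∈S-v : a ∈ S - v
    a∈S-v = x∈p∧x≢y⇒x∈p-y a∈S λ { refl → adj-irrefl va }
    b∈S-v-a : b ∈ S - v - a
    b∈S-v-a = x∈p∧x≢y⇒x∈p-y (x∈p∧x≢y⇒x∈p-y b∈S λ { refl → adj-irrefl vb }) (a≢b ∘ sym)
    deg-T-v : deg T v ≤ 1
    deg-T-v = ≤-pred (≤-pred (≤-trans (s≤s (deg-remove b∈S-v-a vb))
                (≤-trans (deg-remove a∈S-v va) (≤-trans (deg-mono (p─q⊆p S ⁅ v ⁆)) deg-v))))
    T⊆S-v : T ⊆ S - v
    T⊆S-v = p─q⊆p (S - v) ⁅ a ⁆ ∘ p─q⊆p (S - v - a) ⁅ b ⁆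
    deg-T : ∀ {x} → adj G x v ≡ true → deg S x ≤ 3 → deg T x ≤ 2
    deg-T xv deg-x = ≤-pred (≤-trans (s≤s (deg-mono T⊆S-v)) (≤-trans (deg-remove v∈S xv) deg-x))

module Discharging {G : Graph} (S : Subset (n G)) where

  open Degrees G

  private
    V : Set
    V = Fin (n G)

  small : V → Bool
  small v = deg S v ≤ᵇ 3

  neighbour : V → V → Bool
  neighbour v w = lookup S w ∧ adj G v w

  edges : V → V → Bool
  edges u w = lookup S u ∧ neighbour u w

  giver : V → Bool
  giver u = lookup S u ∧ not (small u)

  -- Each vertex of S starts with charge 6 d(v) - 20, summing to 6·2|E| - 20|S| < 0; a vertex of degree
  -- at least 4 then sends one unit to each neighbour of degree at most 3, after which no charge is negative.
  send : V → V → ℕ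
  send u w = 𝟙 (giver u ∧ (small w ∧ neighbour u w))

  edges-sym : ∀ u w → edges u w ≡ edges w u
  edges-sym u w rewrite adj-comm u w with lookup S u | lookup S w
  ... | true  | true  = refl
  ... | true  | false = refl
  ... | false | true  = refl
  ... | false | false = refl

  edges-irrefl : ∀ v → edges v v ≡ false
  edges-irrefl v with lookup S v
  ... | true  = irref G v
  ... | false = refl

  edges-subgraph : IsSubgraph G S edges
  edges-subgraph u w uw =
    let u∈S , w∈S×uw = ∧-conicalˡ (lookup S u) (neighbour u w) uw , ∧-conicalʳ (lookup S u) (neighbour u w) uw
    in ∧-conicalʳ (lookup S w) (adj G u w) w∈S×uw , lookup⇒[]= u S u∈S ,
       lookup⇒[]= w S (∧-conicalˡ (lookup S w) (adj G u w) w∈S×uw)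

  count-edges : ∀ {v} → lookup S v ≡ true → count (edges v) ≡ deg S v
  count-edges {v} v∈S = trans (sum-cong-≗ λ w → cong (λ b → 𝟙 (b ∧ neighbour v w)) v∈S) (sym (deg≡count S v))

  small⇒≤3 : ∀ {v} → small v ≡ true → deg S v ≤ 3
  small⇒≤3 {v} v-small = ≤ᵇ⇒≤ (deg S v) 3 (Equivalence.from T-≡ v-small)

  big⇒≥4 : ∀ {v} → small v ≡ false → 4 ≤ deg S v
  big⇒≥4 {v} v-big = ≰⇒> λ v≤3 → contradiction (trans (sym (dec-true (deg S v ≤? 3) v≤3)) v-big) λ ()

  sends-nothing : ∀ {v} → giver v ≡ false → ∑[ w < n G ] send v w ≡ 0
  sends-nothing {v} v-keeps = trans (sum-cong-≗ λ w → cong (λ g → 𝟙 (g ∧ (small w ∧ neighbour v w))) v-keeps)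
                                    (sum-replicate-zero (n G))

  sends-≤-deg : ∀ v → ∑[ w < n G ] send v w ≤ count (neighbour v)
  sends-≤-deg v = count-mono {p = λ w → giver v ∧ (small w ∧ neighbour v w)} λ w →
    ∧-conicalʳ (small w) (neighbour v w) ∘ ∧-conicalʳ (giver v) (small w ∧ neighbour v w)

  receives : ∀ {v} → lookup S v ≡ true → small v ≡ true → ∀ w → send w v ≡ 𝟙 (neighbour v w ∧ not (small w))
  receives {v} v∈S v-small w = cong 𝟙 (begin
    giver w ∧ (small v ∧ (lookup S v ∧ adj G w v)) ≡⟨ cong₂ (λ s m → giver w ∧ (s ∧ (m ∧ adj G w v))) v-small v∈S ⟩
    giver w ∧ adj G w v                            ≡⟨ cong (giver w ∧_) (adj-comm w v) ⟩
    (lookup S w ∧ not (small w)) ∧ adj G v w       ≡⟨ xy∙z≈xz∙y (lookup S w) (not (small w)) (adj G v w) ⟩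
    neighbour v w ∧ not (small w)                  ∎)
    where open ≡-Reasoning

  module _ (no-low : ¬ LowVertex S) (no-path : ¬ LightPath S) where

    -- Such a vertex has degree exactly 3 and at most one neighbour of degree at most 3, so it receives at least 2.
    charge-small : ∀ {v} → lookup S v ≡ true → small v ≡ true → 20 ≤ 6 * deg S v + ∑[ w < n G ] send w v
    charge-small {v} v∈S v-small = subst (λ d → 20 ≤ 6 * d + received) (sym deg≡3) (+-monoʳ-≤ 18 two≤received)
      where
      received : ℕ
      received = ∑[ w < n G ] send w v
      deg≡3 : deg S v ≡ 3
      deg≡3 = ≤-antisym (small⇒≤3 v-small) (≰⇒> λ v≤2 → no-low (v , lookup⇒[]= v S v∈S , v≤2))
      light-path : ∀ {a b} → (neighbour v a ∧ small a) ≡ true → (neighbour v b ∧ small b) ≡ true → a ≢ b → LightPath S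
      light-path {a} {b} a-ok b-ok a≢b =
        v , a , b , (lookup⇒[]= v S v∈S , member a-ok , member b-ok) , a≢b , adjacent a-ok , adjacent b-ok ,
        small⇒≤3 v-small , small⇒≤3 (∧-conicalʳ (neighbour v a) (small a) a-ok) ,
        small⇒≤3 (∧-conicalʳ (neighbour v b) (small b) b-ok)
        where
        member : ∀ {x} → (neighbour v x ∧ small x) ≡ true → x ∈ S
        member {x} x-ok = lookup⇒[]= x S (∧-conicalˡ (lookup S x) (adj G v x) (∧-conicalˡ (neighbour v x) (small x) x-ok))
        adjacent : ∀ {x} → (neighbour v x ∧ small x) ≡ true → adj G v x ≡ true
        adjacent {x} x-ok = ∧-conicalʳ (lookup S x) (adj G v x) (∧-conicalˡ (neighbour v x) (small x) x-ok)
      few-small : count (λ w → neighbour v w ∧ small w) ≤ 1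
      few-small = count-unique (λ w → neighbour v w ∧ small w) λ a b a-ok b-ok →
        decidable-stable (a ≟ b) (no-path ∘ light-path a-ok b-ok)
      two≤received : 2 ≤ received
      two≤received = ≤-pred (begin
        3                                                                           ≡⟨ deg≡3 ⟨
        deg S v                                                                     ≡⟨ deg≡count S v ⟩
        count (neighbour v)                                                         ≡⟨ count-split (neighbour v) small ⟩
        count (λ w → neighbour v w ∧ small w) + count (λ w → neighbour v w ∧ not (small w)) ≤⟨ +-monoˡ-≤ _ few-small ⟩
        1 + count (λ w → neighbour v w ∧ not (small w))                             ≡⟨ cong suc (sum-cong-≗ (receives v∈S v-small)) ⟨
        1 + received                                                                ∎)
        where open ≤-Reasoning

    charge : ∀ v → 20 * 𝟙 (lookup S v) + ∑[ w < n G ] send v w ≤ 6 * count (edges v) + ∑[ w < n G ] send w v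
    charge v = by-cases (lookup S v) refl (small v) refl
      where
      open ≤-Reasoning
      sent received : ℕ
      sent = ∑[ w < n G ] send v w
      received = ∑[ w < n G ] send w v
      by-cases : ∀ m → lookup S v ≡ m → ∀ s → small v ≡ s → 20 * 𝟙 (lookup S v) + sent ≤ 6 * count (edges v) + received
      by-cases false v∉S _ _ = begin
        20 * 𝟙 (lookup S v) + sent  ≡⟨ cong₂ (λ m x → 20 * 𝟙 m + x) v∉S (sends-nothing {v} (cong (_∧ not (small v)) v∉S)) ⟩
        0                           ≤⟨ z≤n ⟩
        6 * count (edges v) + received ∎
      by-cases true v∈S true v-small = begin
        20 * 𝟙 (lookup S v) + sent  ≡⟨ cong₂ (λ m x → 20 * 𝟙 m + x) v∈S (sends-nothing {v} (cong₂ (λ m s → m ∧ not s) v∈S v-small)) ⟩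
        20                          ≤⟨ charge-small v∈S v-small ⟩
        6 * deg S v + received      ≡⟨ cong (λ d → 6 * d + received) (count-edges v∈S) ⟨
        6 * count (edges v) + received ∎
      by-cases true v∈S false v-big = begin
        20 * 𝟙 (lookup S v) + sent  ≡⟨ cong (λ m → 20 * 𝟙 m + sent) v∈S ⟩
        20 + sent                   ≤⟨ +-monoʳ-≤ 20 (sends-≤-deg v) ⟩
        20 + count (neighbour v)    ≡⟨ cong (20 +_) (deg≡count S v) ⟨
        20 + deg S v                ≡⟨ +-comm 20 (deg S v) ⟩
        deg S v + 20                ≤⟨ +-monoʳ-≤ (deg S v) (*-monoʳ-≤ 5 (big⇒≥4 v-big)) ⟩
        6 * deg S v                 ≡⟨ cong (6 *_) (count-edges v∈S) ⟨
        6 * count (edges v)         ≤⟨ m≤m+n _ _ ⟩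
        6 * count (edges v) + received ∎

    twenty-vertices≤six-degrees : 20 * ∣ S ∣ ≤ 6 * (2 * edgeCount edges)
    twenty-vertices≤six-degrees = +-cancelʳ-≤ sent (20 * ∣ S ∣) (6 * (2 * edgeCount edges)) (begin
      20 * ∣ S ∣ + sent                                                        ≡⟨ cong (λ c → 20 * c + sent) (∣p∣≡count S) ⟩
      20 * count (lookup S) + sent                                             ≡⟨ cong (_+ sent) (*-distribˡ-sum 20 (𝟙 ∘ lookup S)) ⟩
      ∑[ v < n G ] (20 * 𝟙 (lookup S v)) + sent                                 ≡⟨ ∑-distrib-+ (λ v → 20 * 𝟙 (lookup S v)) (λ v → ∑[ w < n G ] send v w) ⟨
      ∑[ v < n G ] (20 * 𝟙 (lookup S v) + ∑[ w < n G ] send v w)                ≤⟨ sum-mono-≤ charge ⟩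
      ∑[ v < n G ] (6 * count (edges v) + ∑[ w < n G ] send w v)                ≡⟨ ∑-distrib-+ (λ v → 6 * count (edges v)) (λ v → ∑[ w < n G ] send w v) ⟩
      ∑[ v < n G ] (6 * count (edges v)) + ∑[ v < n G ] ∑[ w < n G ] send w v   ≡⟨ cong₂ _+_ (*-distribˡ-sum 6 (count ∘ edges)) (sym (∑-comm (λ v w → send w v))) ⟨
      6 * ∑[ v < n G ] count (edges v) + sent                                  ≡⟨ cong (λ e → 6 * e + sent) (handshake edges edges-sym edges-irrefl) ⟩
      6 * (2 * edgeCount edges) + sent                                         ∎)
      where
      open ≤-Reasoning
      sent : ℕ
      sent = ∑[ v < n G ] ∑[ w < n G ] send v w

  irreducible⇒empty : MadLessThan G 10 3 → ¬ LowVertex S → ¬ LightPath S → Empty S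
  irreducible⇒empty mad no-low no-path (v , v∈S) =
    <-irrefl refl (≤-<-trans (twenty-vertices≤six-degrees no-low no-path) six-degrees<twenty-vertices)
    where
    six-degrees<twenty-vertices : 6 * (2 * edgeCount edges) < 20 * ∣ S ∣
    six-degrees<twenty-vertices = subst₂ _<_ (sym (*-assoc 2 3 (2 * edgeCount edges))) (sym (*-assoc 2 10 ∣ S ∣))
      (*-monoʳ-< 2 (mad S edges edges-subgraph (v , v∈S)))

module Induction {G : Graph} (triangle-free : TriangleFree G) (mad : MadLessThan G 10 3) (cover : Cover 4 G) where

  open Degrees G
  open Reductions triangle-free cover

  shrinks : ∀ {m} {S : Subset (n G)} {v} → v ∈ S → ∣ S ∣ ≤ suc m → ∣ S - v ∣ ≤ m
  shrinks v∈S ∣S∣≤1+m = ≤-pred (≤-trans (x∈p⇒∣p-x∣<∣p∣ v∈S) ∣S∣≤1+m)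

  packing : ∀ m S → ∣ S ∣ ≤ m → Packing cover S
  packing zero S ∣S∣≤0 = empty-packing cover {S} λ (v , v∈S) → <⇒≱ (x∈p⇒0<∣p∣ v∈S) ∣S∣≤0
  packing (suc m) S ∣S∣≤1+m with lowVertex? S
  ... | yes (v , v∈S , deg≤2) = reduce-low-degree v∈S deg≤2 (packing m (S - v) (shrinks v∈S ∣S∣≤1+m))
  ... | no no-low with lightPath? S
  ...   | yes (v , a , b , (v∈S , a∈S , b∈S) , a≢b , va , vb , deg-v , deg-a , deg-b) =
    reduce-path v∈S a∈S b∈S a≢b va vb deg-v deg-a deg-b (packing m (S - v - a - b)
      (≤-trans (p⊆q⇒∣p∣≤∣q∣ (p─q⊆p (S - v) ⁅ a ⁆ ∘ p─q⊆p (S - v - a) ⁅ b ⁆)) (shrinks v∈S ∣S∣≤1+m)))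
  ...   | no no-path = empty-packing cover {S} (Discharging.irreducible⇒empty {G} S mad no-low no-path)

theorem15 : (G : Graph) → TriangleFree G → MadLessThan G 10 3 → χ⋆c≤ G 4
theorem15 G triangle-free mad = 4 , s≤s z≤n , ≤-refl , λ cover →
  packing⇒hasPacking cover (Induction.packing triangle-free mad cover (n G) ⊤ (∣p∣≤n ⊤))
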